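{- Let $u$ and $v$ be vertices of a $2$-connected graph $G$. Then the diameter of the $uv$ path graph $\mathcal{P}(G_{uv})$ is at most $2d_G(u,v)$, where $d_G(u,v)$ is the length of a shortest path joining $u$ and $v$ in $G$.
   Context: For a path $L$ and vertices $x,y$ on $L$, $L_{xy}$ denotes the subpath of $L$ joining $x$ and $y$. For vertices $u,v$ of a $2$-connected graph $G$, the $uv$ path graph $\mathcal{P}(G_{uv})$ is the graph whose vertices are the paths in $G$ joining $u$ and $v$, where two such paths $S$ and $T$ are adjacent if $T$ is obtained from $S$ by replacing a subpath $S_{xy}$ of $S$ with a subpath $T_{xy}$ of $T$ that is internally disjoint from $S_{xy}$. The diameter of a connected graph is the maximum distance between pairs of its vertices. -}

module Defs where

open import Level using (0ℓ)
open import Data.Nat using (ℕ; zero; suc; _≤_; _∸_; _*_)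
open import Data.Fin using (Fin)
open import Data.List using (List; []; _∷_; _++_; length)
open import Data.List.Membership.Propositional using (_∈_; _∉_)
open import Data.List.Relation.Unary.Unique.Propositional using (Unique)
open import Data.Product using (Σ; ∃; _×_; _,_; proj₁)
open import Relation.Nullary using (¬_)
open import Relation.Binary.PropositionalEquality using (_≡_; _≢_)

record Graph (n : ℕ) : Set₁ where
  field
    Adj     : Fin n → Fin n → Set
    sym     : ∀ {a b} → Adj a b → Adj b a
    irrefl  : ∀ {a} → ¬ Adj a a
open Graph public

module _ {n : ℕ} (G : Graph n) where

  data Joins : Fin n → Fin n → List (Fin n) → Set where
    single : ∀ {u} → Joins u u (u ∷ [])
    cons   : ∀ {u w v xs} → Adj G u w → Joins w v xs → Joins u v (u ∷ xs)

  IsPath : Fin n → Fin n → List (Fin n) → Set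
  IsPath u v xs = Joins u v xs × Unique xs

  pathLength : List (Fin n) → ℕ
  pathLength xs = length xs ∸ 1

  Connected : Set
  Connected = ∀ a b → ∃ λ xs → IsPath a b xs

  TwoConnected : Set
  TwoConnected =
    3 ≤ n × Connected ×
    (∀ x a b → a ≢ x → b ≢ x → ∃ λ xs → IsPath a b xs × x ∉ xs)

  IsDistance : Fin n → Fin n → ℕ → Set
  IsDistance u v d =
    (∃ λ xs → IsPath u v xs × pathLength xs ≡ d) ×
    (∀ xs → IsPath u v xs → d ≤ pathLength xs)

  UVPath : Fin n → Fin n → Set
  UVPath u v = Σ (List (Fin n)) (IsPath u v)

  -- adjacency in P(G_uv): T is obtained from S by replacing the subpath S_xy
  -- by a subpath T_xy of T internally disjoint from S_xy (and S ≠ T).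
  PGAdj : ∀ {u v} → UVPath u v → UVPath u v → Set
  PGAdj (S , _) (T , _) =
    S ≢ T ×
    ∃ λ (A : List (Fin n)) → ∃ λ (B : List (Fin n)) →
    ∃ λ (P : List (Fin n)) → ∃ λ (Q : List (Fin n)) →
    ∃ λ (x : Fin n) → ∃ λ (y : Fin n) →
      S ≡ A ++ (x ∷ P ++ (y ∷ B)) ×
      T ≡ A ++ (x ∷ Q ++ (y ∷ B)) ×
      (∀ z → z ∈ P → z ∉ Q)

  data Steps {u v : Fin n} : ℕ → UVPath u v → UVPath u v → Set where
    here : ∀ {S} → Steps zero S S
    step : ∀ {k S R T} → PGAdj S R → Steps k R T → Steps (suc k) S T

  DistAtMost : ∀ {u v} → UVPath u v → UVPath u v → ℕ → Set
  DistAtMost S T m = ∃ λ k → k ≤ m × Steps k S T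

  DiamAtMost : Fin n → Fin n → ℕ → Set
  DiamAtMost u v m = ∀ (S T : UVPath u v) → DistAtMost S T m

-- Fix any u–v path L. A u–v path S is moved towards L: where L first leaves
-- the common prefix of S and L it next meets S at some vertex w, and the
-- segment of L up to w is internally disjoint from S, so replacing the
-- corresponding segment of S by it is one step of P(G_uv). Each such step
-- consumes at least one edge of L, so every path reaches L in at most |L|
-- steps, and any two paths are at distance at most 2|L|; taking L shortest
-- gives the bound 2 d(u, v).
module Submission where

open import Defs hiding (sym)
open import Data.Nat using (ℕ; suc; _+_; _*_; _≤_; _<_; z≤n; s≤s)
open import Data.Nat.Induction using (<-wellFounded)
open import Data.Nat.Properties using (≤-trans; n≤1+n; m≤m+n; m≤n+m; +-mono-≤)
open import Data.Fin using (Fin; zero; suc)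
open import Data.Fin.Properties using (_≟_)
open import Data.List using (List; []; _∷_; _++_; [_]; length)
open import Data.List.Properties using (++-assoc; ++-cancelˡ; ++-cancelʳ; ∷-injective; length-++; ≡-dec)
open import Data.List.Membership.Propositional using (_∈_; _∉_)
open import Data.List.Membership.Propositional.Properties using (∈-++⁺ˡ; ∈-++⁺ʳ; ∈-++⁻; ∈-∃++)
open import Data.List.Relation.Binary.Disjoint.Propositional using (Disjoint)
open import Data.List.Relation.Unary.Any as Any using (Any; here; there)
open import Data.List.Relation.Unary.All as All using (All; []; _∷_)
open import Data.List.Relation.Unary.All.Properties using (++⁻ˡ; ++⁻ʳ; ¬Any⇒All¬)
open import Data.List.Relation.Unary.AllPairs using ([]; _∷_)
open import Data.List.Relation.Unary.First as First using (FirstView; fromAny; refine)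
open import Data.List.Relation.Unary.First.Properties using (toView)
open import Data.List.Relation.Unary.Unique.Propositional using (Unique)
open import Data.List.Relation.Unary.Unique.Propositional.Properties using (++⁺; Unique[x∷xs]⇒x∉xs)
open import Data.Product using (Σ; ∃; _×_; _,_; proj₁; proj₂)
open import Data.Sum using (_⊎_; inj₁; inj₂)
open import Data.Empty using (⊥-elim)
open import Induction.WellFounded using (Acc; acc)
open import Relation.Nullary using (yes; no)
open import Relation.Nullary.Decidable using (toSum)
open import Relation.Binary.PropositionalEquality using (_≡_; _≢_; refl; sym; trans; subst)

Unique-++⁻ : ∀ {a} {A : Set a} (xs : List A) {ys} →
             Unique (xs ++ ys) → Unique xs × Unique ys × Disjoint xs ys
Unique-++⁻ []       u          = [] , u , λ ()
Unique-++⁻ (x ∷ xs) (x∉ ∷ u) with Unique-++⁻ xs u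
... | uxs , uys , xs#ys = ++⁻ˡ xs x∉ ∷ uxs , uys , x∷xs#ys
  where
  x∷xs#ys : Disjoint (x ∷ xs) _
  x∷xs#ys (here refl , z∈ys) = All.lookup (++⁻ʳ xs x∉) z∈ys refl
  x∷xs#ys (there z∈xs , z∈ys) = xs#ys (z∈xs , z∈ys)

module _ {n : ℕ} where
  open import Data.List.Membership.DecPropositional (_≟_ {n}) using (_∈?_)

  first-∈ : (ys : List (Fin n)) {xs : List (Fin n)} →
            Any (_∈ ys) xs → FirstView (_∉ ys) (_∈ ys) xs
  first-∈ ys any = toView (refine (λ {x} _ → toSum (x ∈? ys)) (fromAny any))

third-vertex : ∀ {n} → 3 ≤ n → (a b : Fin n) → ∃ λ c → a ≢ c × b ≢ c
third-vertex (s≤s (s≤s (s≤s _))) (suc a)       (suc b)       = zero , (λ ()) , (λ ())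
third-vertex (s≤s (s≤s (s≤s _))) zero          zero          = suc zero , (λ ()) , (λ ())
third-vertex (s≤s (s≤s (s≤s _))) zero          (suc zero)    = suc (suc zero) , (λ ()) , (λ ())
third-vertex (s≤s (s≤s (s≤s _))) zero          (suc (suc _)) = suc zero , (λ ()) , (λ ())
third-vertex (s≤s (s≤s (s≤s _))) (suc zero)    zero          = suc (suc zero) , (λ ()) , (λ ())
third-vertex (s≤s (s≤s (s≤s _))) (suc (suc _)) zero          = suc zero , (λ ()) , (λ ())

module Walks {n : ℕ} (G : Graph n) where

  Joins-head : ∀ {u v xs} → Joins G u v xs → ∃ λ ys → xs ≡ u ∷ ys
  Joins-head single              = [] , refl
  Joins-head (cons {xs = xs} _ _) = xs , refl

  Joins-last∈ : ∀ {u v xs} → Joins G u v xs → v ∈ xs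
  Joins-last∈ single     = here refl
  Joins-last∈ (cons _ j) = there (Joins-last∈ j)

  Joins-++⁻ : ∀ xs {u v x ys} → Joins G u v (xs ++ x ∷ ys) →
              Joins G u x (xs ++ [ x ]) × Joins G x v (x ∷ ys)
  Joins-++⁻ []           single     = single , single
  Joins-++⁻ []           (cons a j) = single , cons a j
  Joins-++⁻ (_ ∷ [])     (cons a j) with Joins-++⁻ [] j
  ... | j₁ , j₂ = cons a j₁ , j₂
  Joins-++⁻ (_ ∷ y ∷ xs) (cons a j) with Joins-++⁻ (y ∷ xs) j
  ... | j₁ , j₂ = cons a j₁ , j₂

  Joins-++⁺ : ∀ xs {u v x ys} → Joins G u x (xs ++ [ x ]) → Joins G x v (x ∷ ys) →
              Joins G u v (xs ++ x ∷ ys)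
  Joins-++⁺ []           single      j₂ = j₂
  Joins-++⁺ []           (cons _ ()) _
  Joins-++⁺ (_ ∷ [])     (cons a j) j₂ = cons a (Joins-++⁺ [] j j₂)
  Joins-++⁺ (_ ∷ y ∷ xs) (cons a j) j₂ = cons a (Joins-++⁺ (y ∷ xs) j j₂)

  IsPath-ends-or-continues : ∀ xs {u v c R} → IsPath G u v (xs ++ c ∷ R) →
                             (R ≡ [] × c ≡ v) ⊎ (c ≢ v × v ∈ R)
  IsPath-ends-or-continues xs (j , uniq) with proj₂ (Joins-++⁻ xs j)
  ... | single    = inj₁ (refl , refl)
  ... | cons _ j₂ = inj₂ (c≢v , Joins-last∈ j₂)
    where
    c∉R = Unique[x∷xs]⇒x∉xs (proj₁ (proj₂ (Unique-++⁻ xs uniq)))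
    c≢v : _ ≢ _
    c≢v refl = c∉R (Joins-last∈ j₂)

  IsPath-splice : ∀ xs ys {u v w zs ws} →
                  IsPath G u v (xs ++ w ∷ zs) → IsPath G u v (ys ++ w ∷ ws) →
                  Disjoint ys (w ∷ zs) → IsPath G u v (ys ++ w ∷ zs)
  IsPath-splice xs ys (jS , uS) (jL , uL) ys#w∷zs =
    Joins-++⁺ ys (proj₁ (Joins-++⁻ ys jL)) (proj₂ (Joins-++⁻ xs jS)) ,
    ++⁺ (proj₁ (Unique-++⁻ ys uL)) (proj₁ (proj₂ (Unique-++⁻ xs uS))) ys#w∷zs

  other-neighbour : TwoConnected G → ∀ {u x} → u ≢ x → ∃ λ p → Adj G u p × p ≢ x
  other-neighbour (n≥3 , _ , cut) {u} {x} u≢x with third-vertex n≥3 u x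
  ... | y , u≢y , x≢y with cut x u y u≢x (λ y≡x → x≢y (sym y≡x))
  ...   | _ , (single , _) , _ = ⊥-elim (u≢y refl)
  ...   | _ , (cons a j , _) , x∉P with Joins-head j
  ...     | _ , refl = _ , a , λ p≡x → x∉P (there (here (sym p≡x)))

  another-path : TwoConnected G → ∀ {u v x xs} → IsPath G u v (u ∷ x ∷ xs) →
                 ∃ λ ys → IsPath G u v ys × ys ≢ u ∷ x ∷ xs
  another-path tc@(_ , _ , cut) {u} {v} {x} (cons _ j , u∉ ∷ _)
    with other-neighbour tc (All.lookup u∉ (here refl))
  ... | p , u~p , p≢x with cut u p v (λ p≡u → irrefl G (subst (Adj G u) p≡u u~p))
                                     (λ v≡u → All.lookup u∉ (Joins-last∈ j) (sym v≡u))
  ...   | P , (jP , uP) , u∉P with Joins-head jP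
  ...     | _ , refl = u ∷ P , (cons u~p jP , ¬Any⇒All¬ P u∉P ∷ uP) ,
                       λ eq → p≢x (proj₁ (∷-injective (proj₂ (∷-injective eq))))

module PathGraph {n : ℕ} (G : Graph n) {u v : Fin n} where
  open Walks G

  private
    Path = UVPath G u v

  PGAdj-sym : {S T : Path} → PGAdj G S T → PGAdj G T S
  PGAdj-sym (S≢T , A , B , P , Q , x , y , eS , eT , P#Q) =
    (λ e → S≢T (sym e)) , A , B , Q , P , x , y , eT , eS , λ z z∈Q z∈P → P#Q z z∈P z∈Q

  Steps-snoc : ∀ {k} {S R T : Path} → Steps G k S R → PGAdj G R T → Steps G (suc k) S T
  Steps-snoc here         a = step a here
  Steps-snoc (step b st) a = step b (Steps-snoc st a)

  Steps-reverse : ∀ {k} {S T : Path} → Steps G k S T → Steps G k T S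
  Steps-reverse here         = here
  Steps-reverse {S = S} (step {R = R} a st) = Steps-snoc (Steps-reverse st) (PGAdj-sym {S} {R} a)

  Steps-trans : ∀ {k m} {S R T : Path} → Steps G k S R → Steps G m R T → Steps G (k + m) S T
  Steps-trans here         st′ = st′
  Steps-trans (step a st) st′ = step a (Steps-trans st st′)

  -- PGAdj only looks at vertex lists, so the endpoints of a nonempty walk can be
  -- exchanged for any paths with the same vertex lists (the Adj-proofs may differ).
  Steps-retargetˡ : ∀ {k} {S S′ T : Path} → Steps G (suc k) S T → proj₁ S ≡ proj₁ S′ →
                    Steps G (suc k) S′ T
  Steps-retargetˡ (step a st) refl = step a st

  Steps-retargetʳ : ∀ {k} {S T T′ : Path} → Steps G (suc k) S T → proj₁ T ≡ proj₁ T′ →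
                    Steps G (suc k) S T′
  Steps-retargetʳ {T′ = T′} (step a here)                refl = step {R = T′} a here
  Steps-retargetʳ {T′ = T′} (step {R = R} a (step b st)) e    =
    step {R = R} a (Steps-retargetʳ {T′ = T′} (step b st) e)

  SameOrAdjacent : Path → Path → Set
  SameOrAdjacent S T = proj₁ S ≡ proj₁ T ⊎ PGAdj G S T

  Approaches : Path → Path → ℕ → Set
  Approaches S L m = proj₁ S ≡ proj₁ L ⊎ ∃ λ k → suc k ≤ m × Steps G (suc k) S L

  Approaches-mono : ∀ {S L m m′} → m ≤ m′ → Approaches S L m → Approaches S L m′
  Approaches-mono _    (inj₁ e)              = inj₁ e
  Approaches-mono m≤m′ (inj₂ (k , k<m , st)) = inj₂ (k , ≤-trans k<m m≤m′ , st)

  Approaches-back : ∀ {S T L m} → SameOrAdjacent S T → Approaches T L m → Approaches S L (suc m)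
  Approaches-back         (inj₁ eq) (inj₁ e)              = inj₁ (trans eq e)
  Approaches-back         (inj₁ eq) (inj₂ (k , k<m , st)) =
    inj₂ (k , ≤-trans k<m (n≤1+n _) , Steps-retargetˡ st (sym eq))
  Approaches-back {T = T} (inj₂ a)  (inj₁ e)              =
    inj₂ (0 , s≤s z≤n , Steps-retargetʳ (step {R = T} a here) e)
  Approaches-back         (inj₂ a)  (inj₂ (k , k<m , st)) = inj₂ (suc k , s≤s k<m , step a st)

  replace-segment : ∀ A {c w} P Q B L₂ (S : Path) → proj₁ S ≡ A ++ c ∷ P ++ w ∷ B →
                    IsPath G u v (A ++ c ∷ Q ++ w ∷ L₂) → All (_∉ P ++ w ∷ B) Q →
                    Σ (IsPath G u v ((A ++ c ∷ Q) ++ w ∷ B)) λ pT → SameOrAdjacent S (_ , pT)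
  replace-segment A {c} {w} P Q B L₂ (_ , pS) refl pL Q∉S₁ = pT , same-or-adjacent
    where
    pS′ = subst (IsPath G u v) (sym (++-assoc A (c ∷ P) (w ∷ B))) pS
    pL′ = subst (IsPath G u v) (sym (++-assoc A (c ∷ Q) (w ∷ L₂))) pL
    AcP#w∷B = proj₂ (proj₂ (Unique-++⁻ (A ++ c ∷ P) (proj₂ pS′)))

    AcQ#w∷B : Disjoint (A ++ c ∷ Q) (w ∷ B)
    AcQ#w∷B (z∈AcQ , z∈w∷B) with ∈-++⁻ A z∈AcQ
    ... | inj₁ z∈A           = AcP#w∷B (∈-++⁺ˡ z∈A , z∈w∷B)
    ... | inj₂ (here refl)   = AcP#w∷B (∈-++⁺ʳ A (here refl) , z∈w∷B)
    ... | inj₂ (there z∈Q)   = All.lookup Q∉S₁ z∈Q (∈-++⁺ʳ P z∈w∷B)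

    pT = IsPath-splice (A ++ c ∷ P) (A ++ c ∷ Q) pS′ pL′ AcQ#w∷B

    same-or-adjacent : SameOrAdjacent (_ , pS) (_ , pT)
    same-or-adjacent with ≡-dec _≟_ P Q
    ... | yes refl = inj₁ (sym (++-assoc A (c ∷ P) (w ∷ B)))
    ... | no P≢Q   = inj₂ (S≢T , A , B , P , Q , c , w , refl , ++-assoc A (c ∷ Q) (w ∷ B) ,
                           λ z z∈P z∈Q → All.lookup Q∉S₁ z∈Q (∈-++⁺ˡ z∈P))
      where
      S≢T : A ++ c ∷ P ++ w ∷ B ≢ (A ++ c ∷ Q) ++ w ∷ B
      S≢T e = P≢Q (++-cancelʳ (w ∷ B) P Q (proj₂ (∷-injective
                (++-cancelˡ A _ _ (trans e (++-assoc A (c ∷ Q) (w ∷ B)))))))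

  approaches-from-common-prefix :
    ∀ A c S₁ L₁ → Acc _<_ (length L₁) → (S L : Path) →
    proj₁ S ≡ A ++ c ∷ S₁ → proj₁ L ≡ A ++ c ∷ L₁ → Approaches S L (length L₁)
  approaches-from-common-prefix A c S₁ L₁ _ (_ , pS) (_ , pL) refl refl
    with IsPath-ends-or-continues A pL | IsPath-ends-or-continues A pS
  ... | inj₁ (refl , _)   | inj₁ (refl , _)   = inj₁ refl
  ... | inj₁ (_ , c≡v)    | inj₂ (c≢v , _)    = ⊥-elim (c≢v c≡v)
  ... | inj₂ (c≢v , _)    | inj₁ (_ , c≡v)    = ⊥-elim (c≢v c≡v)
  approaches-from-common-prefix A c S₁ L₁ (acc rec) S L refl refl
      | inj₂ (_ , v∈L₁) | inj₂ (_ , v∈S₁)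
    with first-∈ S₁ (Any.map (λ { refl → v∈S₁ }) v∈L₁)
  ... | First._++_∷_ {Q} {w} Q∉S₁ w∈S₁ L₂ with ∈-∃++ w∈S₁
  ...   | P , B , refl with replace-segment A P Q B L₂ S refl (proj₂ L) Q∉S₁
  ...     | pT , S→T =
    Approaches-mono (L₂<L₁)
      (Approaches-back S→T
        (approaches-from-common-prefix (A ++ c ∷ Q) w B L₂ (rec L₂<L₁) (_ , pT) L
           refl (sym (++-assoc A (c ∷ Q) (w ∷ L₂)))))
    where
    L₂<L₁ : length L₂ < length (Q ++ w ∷ L₂)
    L₂<L₁ rewrite length-++ Q {w ∷ L₂} = m≤n+m (suc (length L₂)) (length Q)

  approaches : (S L : Path) → Approaches S L (pathLength G (proj₁ L))
  approaches S L@(_ , pL) with Joins-head (proj₁ (proj₂ S)) | Joins-head (proj₁ pL)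
  ... | S₁ , eS | L₁ , refl =
    approaches-from-common-prefix [] u S₁ L₁ (<-wellFounded (length L₁)) S L eS refl

  Approaches-meet : ∀ {S T L m} → Approaches S L m → Approaches T L m →
                    (proj₁ S ≡ proj₁ L × proj₁ T ≡ proj₁ L) ⊎ DistAtMost G S T (2 * m)
  Approaches-meet (inj₁ eS) (inj₁ eT) = inj₁ (eS , eT)
  Approaches-meet {m = m} (inj₂ (k , k<m , st)) (inj₂ (k′ , k′<m , st′)) =
    inj₂ (suc k + suc k′ , +-mono-≤ k<m (≤-trans k′<m (m≤m+n m _)) ,
          Steps-trans st (Steps-reverse st′))
  Approaches-meet {m = m} (inj₂ (k , k<m , st)) (inj₁ eT) =
    inj₂ (suc k , ≤-trans k<m (m≤m+n m _) , Steps-retargetʳ st (sym eT))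
  Approaches-meet {m = m} (inj₁ eS) (inj₂ (k , k<m , st)) =
    inj₂ (suc k , ≤-trans k<m (m≤m+n m _) , Steps-reverse (Steps-retargetʳ st (sym eS)))

  -- Paths with the same vertex list but different Adj-proofs are distinct vertices
  -- of P(G_uv); 2-connectivity supplies a path with another vertex list via which
  -- they are joined.
  same-vertices-dist : TwoConnected G → ∀ {xs} (p q : IsPath G u v xs) →
                       DistAtMost G (xs , p) (xs , q) (2 * pathLength G xs)
  same-vertices-dist _  (single , [] ∷ []) (single , [] ∷ [])  = 0 , z≤n , here
  same-vertices-dist _  (single , _)       (cons _ () , _)
  same-vertices-dist tc p@(cons _ j , _) q with Joins-head j
  ... | _ , refl with another-path tc p
  ...   | ys , pR , ys≢xs with approaches (ys , pR) (_ , p)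
  ...     | inj₁ ys≡xs = ⊥-elim (ys≢xs ys≡xs)
  ...     | inj₂ (k , k<m , st) =
    suc k + suc k , +-mono-≤ k<m (≤-trans k<m (m≤m+n _ _)) ,
    Steps-trans (Steps-reverse st) (Steps-retargetʳ st refl)

  diameter≤2*pathLength : TwoConnected G → (L : Path) →
                          DiamAtMost G u v (2 * pathLength G (proj₁ L))
  diameter≤2*pathLength tc L S T with Approaches-meet (approaches S L) (approaches T L)
  ... | inj₂ dist = dist
  diameter≤2*pathLength tc L (_ , pS) (_ , pT) | inj₁ (refl , refl) =
    same-vertices-dist tc pS pT

theorem2 : ∀ {n : ℕ} (G : Graph n) → TwoConnected G →
    ∀ (u v : Fin n) (d : ℕ) → IsDistance G u v d → DiamAtMost G u v (2 * d)
theorem2 G tc u v d ((L , pL , refl) , _) = PathGraph.diameter≤2*pathLength G tc (L , pL)
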